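{- Let $a$ and $b$ be positive integers such that $a\not\equiv 0 \pmod 4$, $b$ is squarefree, and $\mathcal{D}$ is squarefree, where $\mathcal{D}=a^2+4b$ if $a$ is odd and $\mathcal{D}=(a/2)^2+b$ if $a$ is even. Let $p$ be a prime with $b\not\equiv 0\pmod p$. Then: (1) The prime $p=2$ is an $(a,b)$-Wall-Sun-Sun prime if and only if $(a \bmod 4,\, b\bmod 4)=(3,3)$. (2) If $p\ge 3$ and $a\equiv 0\pmod p$, then $p$ is an $(a,b)$-Wall-Sun-Sun prime if and only if $\operatorname{ord}_{p^2}(b)=\operatorname{ord}_p(b)$ and $a\equiv 0\pmod{p^2}$. (3) If $p\ge 5$ and $\left(\frac{\mathcal{D}}{p}\right)=0$, then $p$ is not an $(a,b)$-Wall-Sun-Sun prime.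
   Context: Let $[U_n]$ be the Lucas sequence defined by $U_0=0$, $U_1=1$, $U_n=aU_{n-1}+bU_{n-2}$ for $n\ge 2$. For an integer $m\ge 2$ with $\gcd(b,m)=1$, $\pi(m)$ denotes the length of the period of $[U_n]$ modulo $m$. An $(a,b)$-Wall-Sun-Sun prime is a prime $p$ with $\gcd(b,p)=1$ such that $\pi(p^2)=\pi(p)$. $\operatorname{ord}_m(b)$ denotes the multiplicative order of $b$ modulo $m$, and $\left(\frac{\cdot}{p}\right)$ is the Legendre symbol. -}

module Defs where

open import Data.Nat using (ℕ; zero; suc; _+_; _*_; _^_; _<_; _≤_; _%_; _/_; ∣_-_∣)
open import Data.Nat.Divisibility using (_∣_)
open import Data.Nat.Coprimality using (Coprime)
open import Data.Product using (Σ; _×_; ∃)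
open import Relation.Binary.PropositionalEquality using (_≡_)

U : ℕ → ℕ → ℕ → ℕ
U a b zero = 0
U a b (suc zero) = 1
U a b (suc (suc n)) = a * U a b (suc n) + b * U a b n

infix 4 _≡_[mod_]
_≡_[mod_] : ℕ → ℕ → ℕ → Set
x ≡ y [mod m ] = m ∣ ∣ x - y ∣

IsPeriod : ℕ → ℕ → ℕ → ℕ → Set
IsPeriod a b m k =
  (0 < k) × (∀ n → U a b (n + k) ≡ U a b n [mod m ]) ×
  (∀ j → 0 < j → (∀ n → U a b (n + j) ≡ U a b n [mod m ]) → k ≤ j)

WallSunSun : ℕ → ℕ → ℕ → Set
WallSunSun a b p = Coprime b p × ∃ λ k → IsPeriod a b p k × IsPeriod a b (p ^ 2) k

IsOrder : ℕ → ℕ → ℕ → Set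
IsOrder m b k = (0 < k) × ((b ^ k) ≡ 1 [mod m ]) × (∀ j → 0 < j → ((b ^ j) ≡ 1 [mod m ]) → k ≤ j)

SquareFree : ℕ → Set
SquareFree n = ∀ d → d * d ∣ n → d ≡ 1

𝒟 : ℕ → ℕ → ℕ
𝒟 a b with a % 2
... | zero = (a / 2) * (a / 2) + b
... | suc _ = a * a + 4 * b

module Submission where

-- Since U satisfies a two-term recurrence, j is a period of U modulo m exactly when
-- (U_j, U_{j+1}) ≡ (0, 1), so π(m) is the least such j > 0.
-- (1) π(2) and π(4) depend only on a, b mod 4 and are computed for the admissible residues.
-- (2) If m ∣ a² then U_{2h+1} ≡ bʰ and U_{2h+2} ≡ (h+1)abʰ (mod m). For p ∣ a this makes
--     π(p) = 2 ord_p(b); then π(p²) = π(p) forces ord_{p²}(b) = ord_p(b) = h and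
--     p² ∣ h a b^{h-1}, where p ∤ h because h < p by Fermat.
-- (3) If p ∣ Δ = a² + 4b, then 6a³2ⁿUₙ ≡ n(12aⁿ⁺² + 2(n-1)(n-2)aⁿΔ) modulo Δ². Read modulo p²
--     at n = π(p²) this gives p² ∣ π(p²); read modulo p it shows that (p-1)p is a period,
--     so π(p) < p² ≤ π(p²).

open import Defs
open import Data.Nat using (ℕ; _%_; _^_; _≥_)
open import Data.Nat.Divisibility using (_∣_)
open import Data.Nat.Primality using (Prime)
open import Data.Product using (_×_; ∃)
open import Relation.Binary.PropositionalEquality using (_≡_)
open import Relation.Nullary using (¬_)
open import Function.Bundles using (_⇔_)

module Arithmetic where
  open import Data.Nat
  open import Data.Nat.Properties
  open import Data.Nat.Divisibility
  open import Data.Nat.Primality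
  open import Data.Nat.Coprimality as Coprimality using (Coprime; coprime-divisor)
  open import Data.Nat.Combinatorics using (_C_; nCk≡n!/k![n-k]!; k![n∸k]!∣n!; nCn≡1)
  open import Data.Nat.DivMod using (m/n*n≡m; m≡m%n+[m/n]*n)
  open import Data.Nat.Tactic.RingSolver using (solve-∀)
  open import Data.Empty using (⊥-elim)
  open import Data.Fin using (zero; suc; toℕ; fromℕ; inject₁)
  open import Data.Fin.Properties using (toℕ-inject₁; toℕ-fromℕ; toℕ<n)
  open import Data.Product using (_,_)
  open import Data.Sum using (inj₁; inj₂; [_,_]′)
  open import Data.Vec.Functional using (Vector; tail; init; last)
  open import Function.Base using (_∘_)
  open import Relation.Binary.PropositionalEquality
  open import Algebra.Bundles using (Semiring)
  import Algebra.Properties.Semiring.Binomial as Binomial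
  import Algebra.Properties.Monoid.Sum as MonoidSum
  import Algebra.Definitions.RawSemiring as RawSemiring
  import Algebra.Definitions.RawMonoid as RawMonoid

  n∣n! : ∀ n .{{_ : NonZero n}} → n ∣ n !
  n∣n! (suc n) = m∣m*n (n !)

  ¬∣⇒coprime : ∀ {p n} → Prime p → ¬ p ∣ n → Coprime n p
  ¬∣⇒coprime p-prime p∤n (d∣n , d∣p) with prime⇒irreducible p-prime d∣p
  ... | inj₁ d≡1 = d≡1
  ... | inj₂ refl = ⊥-elim (p∤n d∣n)

  module _ {p} (p-prime : Prime p) where
    private instance _ = prime⇒nonZero p-prime

    prime∤1 : ¬ p ∣ 1
    prime∤1 p∣1 = nonTrivial⇒≢1 {{prime⇒nonTrivial p-prime}} (∣1⇒≡1 p∣1)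

    prime∤0<n<p : ∀ {n} → 0 < n → n < p → ¬ p ∣ n
    prime∤0<n<p {suc n} _ n<p p∣n = <⇒≱ n<p (∣⇒≤ p∣n)

    prime∤! : ∀ {m} → m < p → ¬ p ∣ m !
    prime∤! {zero} _ = prime∤1
    prime∤! {suc m} m<p p∣m! with euclidsLemma (suc m) (m !) p-prime p∣m!
    ... | inj₁ p∣1+m = prime∤0<n<p (s≤s z≤n) m<p p∣1+m
    ... | inj₂ p∣m!′ = prime∤! (<-trans (n<1+n m) m<p) p∣m!′

    prime∣C : ∀ {k} → 0 < k → k < p → p ∣ p C k
    prime∣C {k} 0<k k<p with euclidsLemma (p C k) (k ! * (p ∸ k) !) p-prime p∣product
      where
      instance _ = k !* (p ∸ k) !≢0
      p∣product : p ∣ (p C k) * (k ! * (p ∸ k) !)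
      p∣product = subst (p ∣_)
        (trans (sym (m/n*n≡m (k![n∸k]!∣n! (<⇒≤ k<p))))
               (cong (_* (k ! * (p ∸ k) !)) (sym (nCk≡n!/k![n-k]! (<⇒≤ k<p)))))
        (n∣n! p)
    ... | inj₁ p∣C = p∣C
    ... | inj₂ p∣k![p∸k]! = ⊥-elim ([ prime∤! k<p , prime∤! (∸-monoʳ-< 0<k (<⇒≤ k<p)) ]′
                                     (euclidsLemma (k !) ((p ∸ k) !) p-prime p∣k![p∸k]!))

  private
    module S = Semiring +-*-semiring
    open MonoidSum S.+-monoid using (sum; sum-init-last)
    open RawSemiring S.rawSemiring using () renaming (_^_ to _^ₛ_)
    open RawMonoid S.+-rawMonoid using () renaming (_×_ to _×ₛ_)

    ^ₛ≡^ : ∀ x n → x ^ₛ n ≡ x ^ n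
    ^ₛ≡^ x zero = refl
    ^ₛ≡^ x (suc n) = cong (x *_) (^ₛ≡^ x n)

    ×ₛ≡* : ∀ n x → n ×ₛ x ≡ n * x
    ×ₛ≡* zero x = refl
    ×ₛ≡* (suc n) x = cong (x +_) (×ₛ≡* n x)

    sum-∣ : ∀ {d} n (f : Vector ℕ n) → (∀ i → d ∣ f i) → d ∣ sum f
    sum-∣ zero f _ = _ ∣0
    sum-∣ (suc n) f d∣f = ∣m∣n⇒∣m+n (d∣f zero) (sum-∣ n (tail f) (d∣f ∘ suc))

  [x+1]^n≡1+x^n+multiple : ∀ {d} n x → (∀ {k} → 0 < k → k < suc n → d ∣ suc n C k) →
                           ∃ λ m → d ∣ m × (x + 1) ^ suc n ≡ 1 + m + x ^ suc n
  [x+1]^n≡1+x^n+multiple {d} n x d∣C = m , d∣m , expansion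
    where
    open Binomial +-*-semiring x 1 using (binomialTerm; theorem)
    term = binomialTerm (suc n)
    m = sum (tail (init term))

    d∣m : d ∣ m
    d∣m = sum-∣ n (tail (init term)) λ i →
      let k = toℕ (inject₁ (suc i)) in
      subst (d ∣_) (sym (×ₛ≡* (suc n C k) _))
        (∣m⇒∣m*n _ (subst (λ j → d ∣ suc n C j) (sym (toℕ-inject₁ (suc i)))
                          (d∣C (s≤s z≤n) (s≤s (toℕ<n i)))))

    first : term zero ≡ 1
    first = begin
      term zero                        ≡⟨ ×ₛ≡* 1 (1 ^ₛ 0 * 1 ^ₛ suc n) ⟩
      1 * (1 * 1 ^ₛ suc n)             ≡⟨ cong (λ y → 1 * (1 * y)) (^ₛ≡^ 1 (suc n)) ⟩
      1 * (1 * 1 ^ suc n)              ≡⟨ cong (λ y → 1 * (1 * y)) (^-zeroˡ (suc n)) ⟩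
      1                                ∎
      where open ≡-Reasoning

    final : last term ≡ x ^ suc n
    final = begin
      last term
        ≡⟨ ×ₛ≡* (suc n C k) (x ^ₛ k * 1 ^ₛ (suc n ∸ k)) ⟩
      (suc n C k) * (x ^ₛ k * 1 ^ₛ (suc n ∸ k))
        ≡⟨ cong (λ j → (suc n C j) * (x ^ₛ j * 1 ^ₛ (suc n ∸ j))) (toℕ-fromℕ (suc n)) ⟩
      (suc n C suc n) * (x ^ₛ suc n * 1 ^ₛ (n ∸ n))
        ≡⟨ cong₂ (λ c y → c * (y * 1 ^ₛ (n ∸ n))) (nCn≡1 (suc n)) (^ₛ≡^ x (suc n)) ⟩
      1 * (x ^ suc n * 1 ^ₛ (n ∸ n))
        ≡⟨ cong (λ j → 1 * (x ^ suc n * 1 ^ₛ j)) (n∸n≡0 n) ⟩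
      1 * (x ^ suc n * 1)
        ≡⟨ trans (*-identityˡ (x ^ suc n * 1)) (*-identityʳ (x ^ suc n)) ⟩
      x ^ suc n
        ∎
      where
      open ≡-Reasoning
      k = toℕ (fromℕ (suc n))

    expansion : (x + 1) ^ suc n ≡ 1 + m + x ^ suc n
    expansion = begin
      (x + 1) ^ suc n         ≡⟨ ^ₛ≡^ (x + 1) (suc n) ⟨
      (x + 1) ^ₛ suc n        ≡⟨ theorem (*-comm x 1) (suc n) ⟩
      sum term                ≡⟨ sum-init-last term ⟩
      term zero + m + last term ≡⟨ cong₂ (λ u v → u + m + v) first final ⟩
      1 + m + x ^ suc n       ∎
      where open ≡-Reasoning

  fermat : ∀ {p} → Prime p → ∀ x → ∃ λ r → x ^ p ≡ x + r * p
  fermat {suc n} p-prime zero = 0 , refl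
  fermat {suc n} p-prime (suc x)
    with [x+1]^n≡1+x^n+multiple n x (prime∣C p-prime) | fermat p-prime x
  ... | _ , divides s refl , expansion | r , x^p≡x+rp = s + r , (begin
    suc x ^ suc n                       ≡⟨ cong (_^ suc n) (+-comm 1 x) ⟩
    (x + 1) ^ suc n                     ≡⟨ expansion ⟩
    1 + s * suc n + x ^ suc n           ≡⟨ cong (1 + s * suc n +_) x^p≡x+rp ⟩
    1 + s * suc n + (x + r * suc n)     ≡⟨ rearrange s r x (suc n) ⟩
    suc x + (s + r) * suc n             ∎)
    where
    open ≡-Reasoning
    rearrange : ∀ s r x p → 1 + s * p + (x + r * p) ≡ suc x + (s + r) * p
    rearrange = solve-∀

  p^2≡p*p : ∀ p → p ^ 2 ≡ p * p
  p^2≡p*p p = cong (p *_) (*-identityʳ p)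

  p∣p^2 : ∀ p → p ∣ p ^ 2
  p∣p^2 p = divides p (p^2≡p*p p)

  p∣x⇒p^2∣x*x : ∀ {p x} → p ∣ x → p ^ 2 ∣ x * x
  p∣x⇒p^2∣x*x {p} {x} p∣x = subst (_∣ x * x) (sym (p^2≡p*p p)) (*-pres-∣ p∣x p∣x)

  p²∣xy⇒p²∣x : ∀ {p x y} → Prime p → ¬ p ∣ y → p ^ 2 ∣ x * y → p ^ 2 ∣ x
  p²∣xy⇒p²∣x {p} {x} {y} p-prime p∤y p²∣xy = lift p∣x p²∣xy
    where
    instance _ = prime⇒nonZero p-prime
    p⊥y : Coprime p y
    p⊥y = Coprimality.sym (¬∣⇒coprime p-prime p∤y)
    p∣x : p ∣ x
    p∣x = coprime-divisor p⊥y (∣-trans (p∣p^2 p) (subst (p ^ 2 ∣_) (*-comm x y) p²∣xy))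
    lift : ∀ {x} → p ∣ x → p ^ 2 ∣ x * y → p ^ 2 ∣ x
    lift (divides c refl) p²∣cpy
      with coprime-divisor p⊥y (*-cancelʳ-∣ p (subst₂ _∣_ (p^2≡p*p p) (regroup c p y) p²∣cpy))
      where
      regroup : ∀ c p y → c * p * y ≡ (y * c) * p
      regroup = solve-∀
    ... | divides e refl = divides e (regroup e p)
      where
      regroup : ∀ e p → e * p * p ≡ e * (p * (p * 1))
      regroup = solve-∀

  𝒟∣a²+4b : ∀ a b → 𝒟 a b ∣ a * a + 4 * b
  𝒟∣a²+4b a b with a % 2 | m≡m%n+[m/n]*n a 2
  ... | zero  | a≡[a/2]*2 = divides 4 (trans (cong (λ z → z * z + 4 * b) a≡[a/2]*2) (regroup (a / 2) b))
    where
    regroup : ∀ h b → (0 + h * 2) * (0 + h * 2) + 4 * b ≡ 4 * (h * h + b)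
    regroup = solve-∀
  ... | suc _ | _ = ∣-refl

open Arithmetic
open import Data.Integer using (ℤ; +_; 0ℤ; 1ℤ; _+_; _*_; _-_; -_; _⊖_; ∣_∣) renaming (_^_ to _^ᶻ_)
import Data.Integer.Properties as ℤ
open import Data.Integer.Divisibility.Signed using () renaming (_∣_ to _∣ᶻ_)
import Data.Integer.Divisibility.Signed as ℤ∣
open import Data.Integer.Tactic.RingSolver using (solve-∀)
import Data.Nat as ℕ
import Data.Nat.Properties as ℕ
import Data.Nat.Divisibility as ℕ∣
open import Data.Nat.DivMod using (m≡m%n+[m/n]*n; m%n<n; m∣n⇒o%n%m≡o%m)
open import Data.Nat.Primality using (euclidsLemma)
open import Data.Empty using (⊥-elim)
open import Data.Product using (_,_; proj₁; proj₂)
open import Data.Sum using (_⊎_; inj₁; inj₂; [_,_]′)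
open import Function.Base using (_∘_)
open import Function.Bundles using (mk⇔; Equivalence)
open import Function.Construct.Composition using (_⇔-∘_)
open import Relation.Binary.Bundles using (Setoid)
open import Relation.Binary.Structures using (IsEquivalence)
open import Relation.Nullary using (Dec; ¬?)
open import Relation.Nullary.Decidable using (True; False; toWitness; toWitnessFalse; map′; _×-dec_; _→-dec_)
open import Relation.Binary.PropositionalEquality
  using (_≢_; refl; sym; trans; cong; cong₂; subst; subst₂)
import Relation.Binary.Reasoning.Setoid as SetoidReasoning

-- Congruences are handled on ℤ, where subtraction is total.
infix 4 _≈_[mod_]
record _≈_[mod_] (x y : ℤ) (m : ℕ) : Set where
  constructor ∣⇒≈
  field ≈⇒∣ : + m ∣ᶻ x - y
open _≈_[mod_]

module _ {m : ℕ} where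

  private
    ≈-via : ∀ {x y z} → x - y ≡ z → + m ∣ᶻ z → x ≈ y [mod m ]
    ≈-via x-y≡z m∣z = ∣⇒≈ (subst (+ m ∣ᶻ_) (sym x-y≡z) m∣z)

  ≈-refl : ∀ {x} → x ≈ x [mod m ]
  ≈-refl {x} = ≈-via (ℤ.+-inverseʳ x) (ℤ∣.∣n⇒∣m*n 0ℤ ℤ∣.∣-refl)

  ≈-reflexive : ∀ {x y} → x ≡ y → x ≈ y [mod m ]
  ≈-reflexive refl = ≈-refl

  ≈-sym : ∀ {x y} → x ≈ y [mod m ] → y ≈ x [mod m ]
  ≈-sym {x} {y} (∣⇒≈ m∣x-y) = ≈-via (identity x y) (ℤ∣.∣m⇒∣-m m∣x-y)
    where
    identity : ∀ x y → y - x ≡ - (x - y)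
    identity = solve-∀

  ≈-trans : ∀ {x y z} → x ≈ y [mod m ] → y ≈ z [mod m ] → x ≈ z [mod m ]
  ≈-trans {x} {y} {z} (∣⇒≈ m∣x-y) (∣⇒≈ m∣y-z) = ≈-via (identity x y z) (ℤ∣.∣m∣n⇒∣m+n m∣x-y m∣y-z)
    where
    identity : ∀ x y z → x - z ≡ (x - y) + (y - z)
    identity = solve-∀

  +-cong : ∀ {x y u v} → x ≈ y [mod m ] → u ≈ v [mod m ] → x + u ≈ y + v [mod m ]
  +-cong {x} {y} {u} {v} (∣⇒≈ m∣x-y) (∣⇒≈ m∣u-v) = ≈-via (identity x y u v) (ℤ∣.∣m∣n⇒∣m+n m∣x-y m∣u-v)
    where
    identity : ∀ x y u v → (x + u) - (y + v) ≡ (x - y) + (u - v)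
    identity = solve-∀

  *-cong : ∀ {x y u v} → x ≈ y [mod m ] → u ≈ v [mod m ] → x * u ≈ y * v [mod m ]
  *-cong {x} {y} {u} {v} (∣⇒≈ m∣x-y) (∣⇒≈ m∣u-v) =
    ≈-via (identity x y u v) (ℤ∣.∣m∣n⇒∣m+n (ℤ∣.∣m⇒∣m*n u m∣x-y) (ℤ∣.∣n⇒∣m*n y m∣u-v))
    where
    identity : ∀ x y u v → x * u - y * v ≡ (x - y) * u + y * (u - v)
    identity = solve-∀

  *-congˡ : ∀ {c x y} → x ≈ y [mod m ] → c * x ≈ c * y [mod m ]
  *-congˡ {c} = *-cong (≈-refl {c})

  ^-cong : ∀ {x y} n → x ≈ y [mod m ] → x ^ᶻ n ≈ y ^ᶻ n [mod m ]
  ^-cong ℕ.zero    _   = ≈-refl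
  ^-cong (ℕ.suc n) x≈y = *-cong x≈y (^-cong n x≈y)

  ∣⇒≈0 : ∀ {x} → + m ∣ᶻ x → x ≈ 0ℤ [mod m ]
  ∣⇒≈0 {x} = ≈-via (ℤ.+-identityʳ x)

  ≈0⇒∣ : ∀ {x} → x ≈ 0ℤ [mod m ] → + m ∣ᶻ x
  ≈0⇒∣ {x} (∣⇒≈ m∣x-0) = subst (+ m ∣ᶻ_) (ℤ.+-identityʳ x) m∣x-0

  x+z≈x : ∀ {x z} → + m ∣ᶻ z → x + z ≈ x [mod m ]
  x+z≈x {x} {z} = ≈-via (identity x z)
    where
    identity : ∀ x z → (x + z) - x ≡ z
    identity = solve-∀

  ≈-isEquivalence : IsEquivalence (_≈_[mod m ])
  ≈-isEquivalence = record { refl = ≈-refl ; sym = ≈-sym ; trans = ≈-trans }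

≈-setoid : ℕ → Setoid _ _
≈-setoid m = record { isEquivalence = ≈-isEquivalence {m} }

module ≈-Reasoning (m : ℕ) = SetoidReasoning (≈-setoid m)

x≈x%m : ∀ x m .{{_ : ℕ.NonZero m}} → + x ≈ + (x % m) [mod m ]
x≈x%m x m = ≈-sym (begin
  + (x % m)                             ≈⟨ x+z≈x (ℤ∣.∣n⇒∣m*n (+ (x ℕ./ m)) ℤ∣.∣-refl) ⟨
  + (x % m) + + (x ℕ./ m) * + m         ≡⟨ cong (λ z → + (x % m) + z) (ℤ.pos-* (x ℕ./ m) m) ⟨
  + (x % m) + + ((x ℕ./ m) ℕ.* m)       ≡⟨ ℤ.pos-+ (x % m) ((x ℕ./ m) ℕ.* m) ⟨
  + (x % m ℕ.+ (x ℕ./ m) ℕ.* m)         ≡⟨ cong +_ (m≡m%n+[m/n]*n x m) ⟨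
  + x                                   ∎)
  where open ≈-Reasoning m

≈-mod-∣ : ∀ {d m x y} → d ∣ m → x ≈ y [mod m ] → x ≈ y [mod d ]
≈-mod-∣ d∣m (∣⇒≈ m∣x-y) = ∣⇒≈ (ℤ∣.∣-trans (ℤ∣.∣ᵤ⇒∣ d∣m) m∣x-y)

∣⊖∣≡∣-∣ : ∀ x y → ∣ x ⊖ y ∣ ≡ ℕ.∣ x - y ∣
∣⊖∣≡∣-∣ ℕ.zero    ℕ.zero    = refl
∣⊖∣≡∣-∣ ℕ.zero    (ℕ.suc y) = refl
∣⊖∣≡∣-∣ (ℕ.suc x) ℕ.zero    = refl
∣⊖∣≡∣-∣ (ℕ.suc x) (ℕ.suc y) = trans (cong ∣_∣ (ℤ.[1+m]⊖[1+n]≡m⊖n x y)) (∣⊖∣≡∣-∣ x y)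

≡[mod]⇔≈[mod] : ∀ {m x y} → x ≡ y [mod m ] ⇔ + x ≈ + y [mod m ]
≡[mod]⇔≈[mod] {m} {x} {y} = mk⇔
  (λ m∣∣x-y∣ → ∣⇒≈ (ℤ∣.∣ᵤ⇒∣ (subst (m ∣_) (sym ∣x-y∣) m∣∣x-y∣)))
  (λ (∣⇒≈ m∣x-y) → subst (m ∣_) ∣x-y∣ (ℤ∣.∣⇒∣ᵤ m∣x-y))
  where
  ∣x-y∣ : ∣ + x - + y ∣ ≡ ℕ.∣ x - y ∣
  ∣x-y∣ = trans (cong ∣_∣ (ℤ.[+m]-[+n]≡m⊖n x y)) (∣⊖∣≡∣-∣ x y)

pos-^ : ∀ x n → + (x ^ n) ≡ (+ x) ^ᶻ n
pos-^ x ℕ.zero    = refl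
pos-^ x (ℕ.suc n) = trans (ℤ.pos-* x (x ^ n)) (cong (+ x *_) (pos-^ x n))

^≡1[mod]⇔ : ∀ {m} b k → b ^ k ≡ 1 [mod m ] ⇔ (+ b) ^ᶻ k ≈ 1ℤ [mod m ]
^≡1[mod]⇔ {m} b k = mk⇔
  (λ b^k≡1 → subst (_≈ 1ℤ [mod m ]) (pos-^ b k) (Equivalence.to ≡[mod]⇔≈[mod] b^k≡1))
  (λ b^k≈1 → Equivalence.from ≡[mod]⇔≈[mod] (subst (_≈ 1ℤ [mod m ]) (sym (pos-^ b k)) b^k≈1))

module _ {p} (p-prime : Prime p) where

  euclidsLemmaᶻ : ∀ x y → + p ∣ᶻ x * y → + p ∣ᶻ x ⊎ + p ∣ᶻ y
  euclidsLemmaᶻ x y p∣xy with euclidsLemma ∣ x ∣ ∣ y ∣ p-prime (subst (p ∣_) (ℤ.abs-* x y) (ℤ∣.∣⇒∣ᵤ p∣xy))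
  ... | inj₁ p∣x = inj₁ (ℤ∣.∣ᵤ⇒∣ p∣x)
  ... | inj₂ p∣y = inj₂ (ℤ∣.∣ᵤ⇒∣ p∣y)

  ∤-* : ∀ {x y} → ¬ + p ∣ᶻ x → ¬ + p ∣ᶻ y → ¬ + p ∣ᶻ x * y
  ∤-* {x} {y} p∤x p∤y p∣xy = [ p∤x , p∤y ]′ (euclidsLemmaᶻ x y p∣xy)

  ∤-^ : ∀ {x} → ¬ + p ∣ᶻ x → ∀ n → ¬ + p ∣ᶻ x ^ᶻ n
  ∤-^ p∤x ℕ.zero    p∣1 = prime∤1 p-prime (ℤ∣.∣⇒∣ᵤ p∣1)
  ∤-^ p∤x (ℕ.suc n) = ∤-* p∤x (∤-^ p∤x n)

  *-cancelˡ-≈ : ∀ {c x y} → ¬ + p ∣ᶻ c → c * x ≈ c * y [mod p ] → x ≈ y [mod p ]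
  *-cancelˡ-≈ {c} {x} {y} p∤c (∣⇒≈ p∣cx-cy)
    with euclidsLemmaᶻ c (x - y) (subst (+ p ∣ᶻ_) (identity c x y) p∣cx-cy)
    where
    identity : ∀ c x y → c * x - c * y ≡ c * (x - y)
    identity = solve-∀
  ... | inj₁ p∣c   = ⊥-elim (p∤c p∣c)
  ... | inj₂ p∣x-y = ∣⇒≈ p∣x-y

  fermat-≈ : ∀ x → (+ x) ^ᶻ p ≈ + x [mod p ]
  fermat-≈ x with fermat p-prime x
  ... | r , x^p≡x+rp = begin
    (+ x) ^ᶻ p         ≡⟨ pos-^ x p ⟨
    + (x ^ p)          ≡⟨ cong +_ x^p≡x+rp ⟩
    + (x ℕ.+ r ℕ.* p)  ≡⟨ trans (ℤ.pos-+ x (r ℕ.* p)) (cong (λ z → + x + z) (ℤ.pos-* r p)) ⟩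
    + x + + r * + p    ≈⟨ x+z≈x (ℤ∣.∣n⇒∣m*n (+ r) ℤ∣.∣-refl) ⟩
    + x                ∎
    where open ≈-Reasoning p

fermat-unit : ∀ {p x} → Prime p → ¬ p ∣ x → (+ x) ^ᶻ (p ℕ.∸ 1) ≈ 1ℤ [mod p ]
fermat-unit {ℕ.suc q} {x} p-prime p∤x = *-cancelˡ-≈ p-prime {+ x} (λ p∣x → p∤x (ℤ∣.∣⇒∣ᵤ p∣x))
  (≈-trans (fermat-≈ p-prime x) (≈-reflexive (sym (ℤ.*-identityʳ (+ x)))))

^[p-1]p≈1 : ∀ {p x} → Prime p → ¬ p ∣ x → (+ x) ^ᶻ ((p ℕ.∸ 1) ℕ.* p) ≈ 1ℤ [mod p ]
^[p-1]p≈1 {p} {x} p-prime p∤x = begin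
  (+ x) ^ᶻ ((p ℕ.∸ 1) ℕ.* p)  ≡⟨ ℤ.^-*-assoc (+ x) (p ℕ.∸ 1) p ⟨
  ((+ x) ^ᶻ (p ℕ.∸ 1)) ^ᶻ p   ≈⟨ ^-cong p (fermat-unit p-prime p∤x) ⟩
  1ℤ ^ᶻ p                     ≡⟨ ℤ.^-zeroˡ p ⟩
  1ℤ                          ∎
  where open ≈-Reasoning p

Uᶻ : ℤ → ℤ → ℕ → ℤ
Uᶻ a b ℕ.zero              = 0ℤ
Uᶻ a b (ℕ.suc ℕ.zero)      = 1ℤ
Uᶻ a b (ℕ.suc (ℕ.suc n))   = a * Uᶻ a b (ℕ.suc n) + b * Uᶻ a b n

U≡Uᶻ : ∀ a b n → + U a b n ≡ Uᶻ (+ a) (+ b) n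
U≡Uᶻ a b ℕ.zero            = refl
U≡Uᶻ a b (ℕ.suc ℕ.zero)    = refl
U≡Uᶻ a b (ℕ.suc (ℕ.suc n)) = trans (ℤ.pos-+ (a ℕ.* U a b (ℕ.suc n)) (b ℕ.* U a b n))
  (cong₂ _+_ (trans (ℤ.pos-* a _) (cong (+ a *_) (U≡Uᶻ a b (ℕ.suc n))))
             (trans (ℤ.pos-* b _) (cong (+ b *_) (U≡Uᶻ a b n))))

U≡[mod]⇔Uᶻ≈[mod] : ∀ a b {m} i j → U a b i ≡ U a b j [mod m ] ⇔ Uᶻ (+ a) (+ b) i ≈ Uᶻ (+ a) (+ b) j [mod m ]
U≡[mod]⇔Uᶻ≈[mod] a b {m} i j = mk⇔
  (λ Uᵢ≡Uⱼ → subst₂ (_≈_[mod m ]) (U≡Uᶻ a b i) (U≡Uᶻ a b j) (Equivalence.to ≡[mod]⇔≈[mod] Uᵢ≡Uⱼ))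
  (λ Uᵢ≈Uⱼ → Equivalence.from ≡[mod]⇔≈[mod] (subst₂ (_≈_[mod m ]) (sym (U≡Uᶻ a b i)) (sym (U≡Uᶻ a b j)) Uᵢ≈Uⱼ))

Uᶻ-cong : ∀ {a a′ b b′ m} → a ≈ a′ [mod m ] → b ≈ b′ [mod m ] → ∀ n → Uᶻ a b n ≈ Uᶻ a′ b′ n [mod m ]
Uᶻ-cong a≈a′ b≈b′ ℕ.zero            = ≈-refl
Uᶻ-cong a≈a′ b≈b′ (ℕ.suc ℕ.zero)    = ≈-refl
Uᶻ-cong a≈a′ b≈b′ (ℕ.suc (ℕ.suc n)) =
  +-cong (*-cong a≈a′ (Uᶻ-cong a≈a′ b≈b′ (ℕ.suc n))) (*-cong b≈b′ (Uᶻ-cong a≈a′ b≈b′ n))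

Resets : ℤ → ℤ → ℕ → ℕ → Set
Resets a b m j = Uᶻ a b j ≈ 0ℤ [mod m ] × Uᶻ a b (ℕ.suc j) ≈ 1ℤ [mod m ]

Resets⇒periodic : ∀ {a b m j} → Resets a b m j → ∀ n → Uᶻ a b (n ℕ.+ j) ≈ Uᶻ a b n [mod m ]
Resets⇒periodic {a} {b} {m} {j} resets n = proj₁ (pair n)
  where
  pair : ∀ n → Uᶻ a b (n ℕ.+ j) ≈ Uᶻ a b n [mod m ] × Uᶻ a b (ℕ.suc n ℕ.+ j) ≈ Uᶻ a b (ℕ.suc n) [mod m ]
  pair ℕ.zero    = resets
  pair (ℕ.suc n) = proj₂ (pair n) , +-cong (*-congˡ {c = a} (proj₂ (pair n))) (*-congˡ {c = b} (proj₁ (pair n)))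

periodic⇔Resets : ∀ {a b m j} → (∀ n → U a b (n ℕ.+ j) ≡ U a b n [mod m ]) ⇔ Resets (+ a) (+ b) m j
periodic⇔Resets {a} {b} {m} {j} = mk⇔
  (λ periodic → Equivalence.to (U≡[mod]⇔Uᶻ≈[mod] a b j 0) (periodic 0) ,
                Equivalence.to (U≡[mod]⇔Uᶻ≈[mod] a b (ℕ.suc j) 1) (periodic 1))
  (λ resets n → Equivalence.from (U≡[mod]⇔Uᶻ≈[mod] a b (n ℕ.+ j) n) (Resets⇒periodic resets n))

Resets-cong : ∀ {a a′ b b′ m j} → a ≈ a′ [mod m ] → b ≈ b′ [mod m ] → Resets a b m j → Resets a′ b′ m j
Resets-cong {j = j} a≈a′ b≈b′ (Uⱼ≈0 , Uⱼ₊₁≈1) =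
  ≈-trans (≈-sym (Uᶻ-cong a≈a′ b≈b′ j)) Uⱼ≈0 , ≈-trans (≈-sym (Uᶻ-cong a≈a′ b≈b′ (ℕ.suc j))) Uⱼ₊₁≈1

IsPeriodᶻ : ℤ → ℤ → ℕ → ℕ → Set
IsPeriodᶻ a b m k = 0 ℕ.< k × Resets a b m k × (∀ j → 0 ℕ.< j → Resets a b m j → k ℕ.≤ j)

IsPeriod⇔IsPeriodᶻ : ∀ {a b m k} → IsPeriod a b m k ⇔ IsPeriodᶻ (+ a) (+ b) m k
IsPeriod⇔IsPeriodᶻ = mk⇔
  (λ (0<k , periodic , least) → 0<k , Equivalence.to periodic⇔Resets periodic ,
                                λ j 0<j resets → least j 0<j (Equivalence.from periodic⇔Resets resets))
  (λ (0<k , resets , least) → 0<k , Equivalence.from periodic⇔Resets resets ,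
                              λ j 0<j periodic → least j 0<j (Equivalence.to periodic⇔Resets periodic))

IsPeriodᶻ-unique : ∀ {a b m k l} → IsPeriodᶻ a b m k → IsPeriodᶻ a b m l → k ≡ l
IsPeriodᶻ-unique (0<k , resetsₖ , leastₖ) (0<l , resetsₗ , leastₗ) =
  ℕ.≤-antisym (leastₖ _ 0<l resetsₗ) (leastₗ _ 0<k resetsₖ)

IsPeriodᶻ-cong : ∀ {a a′ b b′ m k} → a ≈ a′ [mod m ] → b ≈ b′ [mod m ] → IsPeriodᶻ a b m k → IsPeriodᶻ a′ b′ m k
IsPeriodᶻ-cong {k = k} a≈a′ b≈b′ (0<k , resets , least) =
  0<k , Resets-cong {j = k} a≈a′ b≈b′ resets ,
  λ j 0<j resets′ → least j 0<j (Resets-cong {j = j} (≈-sym a≈a′) (≈-sym b≈b′) resets′)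

SamePeriod : ℤ → ℤ → ℕ → ℕ → Set
SamePeriod a b m n = ∃ λ k → IsPeriodᶻ a b m k × IsPeriodᶻ a b n k

WallSunSun⇔SamePeriod : ∀ {a b p} → Prime p → ¬ p ∣ b → WallSunSun a b p ⇔ SamePeriod (+ a) (+ b) p (p ^ 2)
WallSunSun⇔SamePeriod p-prime p∤b = mk⇔
  (λ (_ , k , πₚ , πₚ²) → k , Equivalence.to IsPeriod⇔IsPeriodᶻ πₚ , Equivalence.to IsPeriod⇔IsPeriodᶻ πₚ²)
  (λ (k , πₚ , πₚ²) → ¬∣⇒coprime p-prime p∤b , k , Equivalence.from IsPeriod⇔IsPeriodᶻ πₚ ,
                      Equivalence.from IsPeriod⇔IsPeriodᶻ πₚ²)

_≈?_[mod_] : ∀ x y m → Dec (x ≈ y [mod m ])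
x ≈? y [mod m ] = map′ ∣⇒≈ ≈⇒∣ (+ m ℤ∣.∣? (x - y))

Resets? : ∀ a b m j → Dec (Resets a b m j)
Resets? a b m j = (Uᶻ a b j ≈? 0ℤ [mod m ]) ×-dec (Uᶻ a b (ℕ.suc j) ≈? 1ℤ [mod m ])

IsPeriodᶻ? : ∀ a b m k → Dec (IsPeriodᶻ a b m k)
IsPeriodᶻ? a b m k = map′ bounded⇒least least⇒bounded
  ((0 ℕ.<? k) ×-dec (Resets? a b m k ×-dec ℕ.allUpTo? (λ j → (0 ℕ.<? j) →-dec ¬? (Resets? a b m j)) k))
  where
  NoEarlierReset = ∀ {j} → j ℕ.< k → 0 ℕ.< j → ¬ Resets a b m j
  bounded⇒least : 0 ℕ.< k × Resets a b m k × NoEarlierReset → IsPeriodᶻ a b m k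
  bounded⇒least (0<k , resets , none) = 0<k , resets , λ j 0<j resetsⱼ → ℕ.≮⇒≥ (λ j<k → none j<k 0<j resetsⱼ)
  least⇒bounded : IsPeriodᶻ a b m k → 0 ℕ.< k × Resets a b m k × NoEarlierReset
  least⇒bounded (0<k , resets , least) = 0<k , resets , λ j<k 0<j resetsⱼ → ℕ.<⇒≱ j<k (least _ 0<j resetsⱼ)

SamePeriod-cong : ∀ {a a′ b b′ m n} → m ∣ n → a ≈ a′ [mod n ] → b ≈ b′ [mod n ] →
                  SamePeriod a b m n → SamePeriod a′ b′ m n
SamePeriod-cong m∣n a≈a′ b≈b′ (k , πₘ , πₙ) =
  k , IsPeriodᶻ-cong (≈-mod-∣ m∣n a≈a′) (≈-mod-∣ m∣n b≈b′) πₘ , IsPeriodᶻ-cong a≈a′ b≈b′ πₙ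

IsPeriodᶻ-by-computation : ∀ a b m k → {True (IsPeriodᶻ? (+ a) (+ b) m k)} → IsPeriodᶻ (+ a) (+ b) m k
IsPeriodᶻ-by-computation a b m k {computed} = toWitness computed

¬SamePeriod-by-computation : ∀ a b m n k l → {True (IsPeriodᶻ? (+ a) (+ b) m k)} →
                             {True (IsPeriodᶻ? (+ a) (+ b) n l)} → {False (k ℕ.≟ l)} → ¬ SamePeriod (+ a) (+ b) m n
¬SamePeriod-by-computation a b m n k l {πₘ} {πₙ} {k≢l} (j , πₘ′ , πₙ′) =
  toWitnessFalse k≢l (trans (IsPeriodᶻ-unique (toWitness πₘ) πₘ′) (IsPeriodᶻ-unique πₙ′ (toWitness πₙ)))

SamePeriod-mod-4-residues : ∀ r s → r ℕ.< 4 → s ℕ.< 4 → r ≢ 0 → ¬ 2 ∣ s →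
                            SamePeriod (+ r) (+ s) 2 4 ⇔ (r ≡ 3 × s ≡ 3)
SamePeriod-mod-4-residues 0 _ _ _ r≢0 _ = ⊥-elim (r≢0 refl)
SamePeriod-mod-4-residues _ 0 _ _ _ 2∤s = ⊥-elim (2∤s (ℕ∣.divides 0 refl))
SamePeriod-mod-4-residues _ 2 _ _ _ 2∤s = ⊥-elim (2∤s (ℕ∣.divides 1 refl))
SamePeriod-mod-4-residues 1 1 _ _ _ _ = mk⇔ (⊥-elim ∘ ¬SamePeriod-by-computation 1 1 2 4 3 6) λ { (() , _) }
SamePeriod-mod-4-residues 1 3 _ _ _ _ = mk⇔ (⊥-elim ∘ ¬SamePeriod-by-computation 1 3 2 4 3 6) λ { (() , _) }
SamePeriod-mod-4-residues 2 1 _ _ _ _ = mk⇔ (⊥-elim ∘ ¬SamePeriod-by-computation 2 1 2 4 2 4) λ { (() , _) }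
SamePeriod-mod-4-residues 2 3 _ _ _ _ = mk⇔ (⊥-elim ∘ ¬SamePeriod-by-computation 2 3 2 4 2 4) λ { (() , _) }
SamePeriod-mod-4-residues 3 1 _ _ _ _ = mk⇔ (⊥-elim ∘ ¬SamePeriod-by-computation 3 1 2 4 3 6) λ { (_ , ()) }
SamePeriod-mod-4-residues 3 3 _ _ _ _ =
  mk⇔ (λ _ → refl , refl) (λ _ → 3 , IsPeriodᶻ-by-computation 3 3 2 3 , IsPeriodᶻ-by-computation 3 3 4 3)
SamePeriod-mod-4-residues (ℕ.suc (ℕ.suc (ℕ.suc (ℕ.suc _)))) _ (ℕ.s≤s (ℕ.s≤s (ℕ.s≤s (ℕ.s≤s ())))) _ _ _
SamePeriod-mod-4-residues _ (ℕ.suc (ℕ.suc (ℕ.suc (ℕ.suc _)))) _ (ℕ.s≤s (ℕ.s≤s (ℕ.s≤s (ℕ.s≤s ())))) _ _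

SamePeriod-mod-2-4⇔ : ∀ {a b} → ¬ 4 ∣ a → ¬ 2 ∣ b → SamePeriod (+ a) (+ b) 2 4 ⇔ (a % 4 ≡ 3 × b % 4 ≡ 3)
SamePeriod-mod-2-4⇔ {a} {b} 4∤a 2∤b =
  SamePeriod-mod-4-residues (a % 4) (b % 4) (m%n<n a 4) (m%n<n b 4) (4∤a ∘ ℕ∣.m%n≡0⇒n∣m a 4) 2∤b%4
  ⇔-∘ mk⇔ (SamePeriod-cong 2∣4 (x≈x%m a 4) (x≈x%m b 4))
          (SamePeriod-cong 2∣4 (≈-sym (x≈x%m a 4)) (≈-sym (x≈x%m b 4)))
  where
  2∣4 : 2 ∣ 4
  2∣4 = ℕ∣.divides 2 refl
  2∤b%4 : ¬ 2 ∣ b % 4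
  2∤b%4 2∣b%4 = 2∤b (ℕ∣.m%n≡0⇒n∣m b 2
    (trans (sym (m∣n⇒o%n%m≡o%m 2 4 b 2∣4)) (ℕ∣.n∣m⇒m%n≡0 (b % 4) 2 2∣b%4)))

double : ℕ → ℕ
double ℕ.zero    = ℕ.zero
double (ℕ.suc n) = ℕ.suc (ℕ.suc (double n))

data EvenOdd : ℕ → Set where
  even : ∀ h → EvenOdd (double h)
  odd  : ∀ h → EvenOdd (ℕ.suc (double h))

evenOdd : ∀ n → EvenOdd n
evenOdd ℕ.zero = even 0
evenOdd (ℕ.suc n) with evenOdd n
... | even h = odd h
... | odd h  = even (ℕ.suc h)

double-mono-≤ : ∀ {h h′} → h ℕ.≤ h′ → double h ℕ.≤ double h′
double-mono-≤ ℕ.z≤n       = ℕ.z≤n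
double-mono-≤ (ℕ.s≤s h≤h′) = ℕ.s≤s (ℕ.s≤s (double-mono-≤ h≤h′))

double-cancel-≤ : ∀ {h h′} → double h ℕ.≤ double h′ → h ℕ.≤ h′
double-cancel-≤ {ℕ.zero}             _                          = ℕ.z≤n
double-cancel-≤ {ℕ.suc h} {ℕ.suc h′} (ℕ.s≤s (ℕ.s≤s 2h≤2h′)) = ℕ.s≤s (double-cancel-≤ 2h≤2h′)

module _ {m} (a b : ℤ) (m∣a² : + m ∣ᶻ a * a) where

  private
    Uᶻ-odd-even : ∀ h → Uᶻ a b (ℕ.suc (double h)) ≈ b ^ᶻ h [mod m ] ×
                        Uᶻ a b (double (ℕ.suc h)) ≈ + ℕ.suc h * a * b ^ᶻ h [mod m ]
    Uᶻ-odd-even ℕ.zero = ≈-refl , ≈-reflexive (identity a b)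
      where
      identity : ∀ a b → a * 1ℤ + b * 0ℤ ≡ 1ℤ * a * 1ℤ
      identity = solve-∀
    Uᶻ-odd-even (ℕ.suc h) = Uₒ , Uₑ
      where
      open ≈-Reasoning m
      H = + h
      B = b ^ᶻ h
      Uₒ : Uᶻ a b (ℕ.suc (double (ℕ.suc h))) ≈ b ^ᶻ ℕ.suc h [mod m ]
      Uₒ = begin
        a * Uᶻ a b (double (ℕ.suc h)) + b * Uᶻ a b (ℕ.suc (double h))
          ≈⟨ +-cong (*-congˡ {c = a} (proj₂ (Uᶻ-odd-even h))) (*-congˡ {c = b} (proj₁ (Uᶻ-odd-even h))) ⟩
        a * (+ ℕ.suc h * a * B) + b * B      ≡⟨ cong (λ n → a * (n * a * B) + b * B) (ℤ.pos-+ 1 h) ⟩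
        a * ((1ℤ + H) * a * B) + b * B      ≡⟨ identity a b B H ⟩
        b * B + (a * a) * ((1ℤ + H) * B)    ≈⟨ x+z≈x (ℤ∣.∣m⇒∣m*n ((1ℤ + H) * B) m∣a²) ⟩
        b * B                               ∎
        where
        identity : ∀ a b B H → a * ((1ℤ + H) * a * B) + b * B ≡ b * B + (a * a) * ((1ℤ + H) * B)
        identity = solve-∀
      Uₑ : Uᶻ a b (double (ℕ.suc (ℕ.suc h))) ≈ + ℕ.suc (ℕ.suc h) * a * b ^ᶻ ℕ.suc h [mod m ]
      Uₑ = begin
        a * Uᶻ a b (ℕ.suc (double (ℕ.suc h))) + b * Uᶻ a b (double (ℕ.suc h))
          ≈⟨ +-cong (*-congˡ {c = a} Uₒ) (*-congˡ {c = b} (proj₂ (Uᶻ-odd-even h))) ⟩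
        a * (b * B) + b * (+ ℕ.suc h * a * B)  ≡⟨ cong (λ n → a * (b * B) + b * (n * a * B)) (ℤ.pos-+ 1 h) ⟩
        a * (b * B) + b * ((1ℤ + H) * a * B)  ≡⟨ identity a b B H ⟩
        (+ 2 + H) * a * (b * B)               ≡⟨ cong (λ n → n * a * (b * B)) (ℤ.pos-+ 2 h) ⟨
        + ℕ.suc (ℕ.suc h) * a * (b * B)       ∎
        where
        identity : ∀ a b B H → a * (b * B) + b * ((1ℤ + H) * a * B) ≡ (+ 2 + H) * a * (b * B)
        identity = solve-∀

  Uᶻ-odd : ∀ h → Uᶻ a b (ℕ.suc (double h)) ≈ b ^ᶻ h [mod m ]
  Uᶻ-odd h = proj₁ (Uᶻ-odd-even h)

  Uᶻ-even : ∀ h → Uᶻ a b (double (ℕ.suc h)) ≈ + ℕ.suc h * a * b ^ᶻ h [mod m ]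
  Uᶻ-even h = proj₂ (Uᶻ-odd-even h)

Resets-double : ∀ {m a b} h → + m ∣ᶻ a → b ^ᶻ h ≈ 1ℤ [mod m ] → Resets a b m (double h)
Resets-double ℕ.zero _ _ = ≈-refl , ≈-refl
Resets-double {m} {a} {b} h@(ℕ.suc h′) m∣a b^h≈1 =
    ≈-trans (Uᶻ-even a b m∣a² h′) (∣⇒≈0 (ℤ∣.∣m⇒∣m*n (b ^ᶻ h′) (ℤ∣.∣n⇒∣m*n (+ h) m∣a)))
  , ≈-trans (Uᶻ-odd a b m∣a² h) b^h≈1
  where
  m∣a² = ℤ∣.∣m⇒∣m*n a m∣a

Resets-double⇒^≈1 : ∀ {m a b} h → + m ∣ᶻ a * a → Resets a b m (double h) → b ^ᶻ h ≈ 1ℤ [mod m ]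
Resets-double⇒^≈1 {a = a} {b} h m∣a² (_ , U₂ₕ₊₁≈1) = ≈-trans (≈-sym (Uᶻ-odd a b m∣a² h)) U₂ₕ₊₁≈1

¬Resets-odd : ∀ {p m a b} h → Prime p → p ∣ m → + m ∣ᶻ a * a → ¬ + p ∣ᶻ b → ¬ Resets a b m (ℕ.suc (double h))
¬Resets-odd {a = a} {b} h p-prime p∣m m∣a² p∤b (U₂ₕ₊₁≈0 , _) =
  ∤-^ p-prime p∤b h (≈0⇒∣ (≈-mod-∣ p∣m (≈-trans (≈-sym (Uᶻ-odd a b m∣a² h)) U₂ₕ₊₁≈0)))

module _ {p m a b} (p-prime : Prime p) (p∣m : p ∣ m) (m∣a : m ∣ a) (p∤b : ¬ p ∣ b) where

  private
    m∣ᶻa = ℤ∣.∣ᵤ⇒∣ {+ m} {+ a} m∣a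
    m∣ᶻa² = ℤ∣.∣m⇒∣m*n (+ a) m∣ᶻa
    p∤ᶻb : ¬ + p ∣ᶻ + b
    p∤ᶻb = p∤b ∘ ℤ∣.∣⇒∣ᵤ

    Resets-double⇒≡1 : ∀ h → Resets (+ a) (+ b) m (double h) → b ^ h ≡ 1 [mod m ]
    Resets-double⇒≡1 h = Equivalence.from (^≡1[mod]⇔ b h) ∘ Resets-double⇒^≈1 h m∣ᶻa²

    ≡1⇒Resets-double : ∀ h → b ^ h ≡ 1 [mod m ] → Resets (+ a) (+ b) m (double h)
    ≡1⇒Resets-double h = Resets-double h m∣ᶻa ∘ Equivalence.to (^≡1[mod]⇔ b h)

  IsOrder⇒IsPeriodᶻ-double : ∀ {h} → IsOrder m b h → IsPeriodᶻ (+ a) (+ b) m (double h)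
  IsOrder⇒IsPeriodᶻ-double {h@(ℕ.suc _)} (_ , b^h≡1 , least) =
    ℕ.s≤s ℕ.z≤n , ≡1⇒Resets-double h b^h≡1 , λ j 0<j → resets⇒≤ j 0<j (evenOdd j)
    where
    resets⇒≤ : ∀ j → 0 ℕ.< j → EvenOdd j → Resets (+ a) (+ b) m j → double h ℕ.≤ j
    resets⇒≤ _ () (even ℕ.zero)
    resets⇒≤ _ _  (even j@(ℕ.suc _)) resets = double-mono-≤ (least j (ℕ.s≤s ℕ.z≤n) (Resets-double⇒≡1 j resets))
    resets⇒≤ _ _  (odd j) resets = ⊥-elim (¬Resets-odd j p-prime p∣m m∣ᶻa² p∤ᶻb resets)

  IsPeriodᶻ⇒IsOrder-half : ∀ {k} → IsPeriodᶻ (+ a) (+ b) m k → ∃ λ h → k ≡ double h × IsOrder m b h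
  IsPeriodᶻ⇒IsOrder-half {k} = half (evenOdd k)
    where
    half : ∀ {k} → EvenOdd k → IsPeriodᶻ (+ a) (+ b) m k → ∃ λ h → k ≡ double h × IsOrder m b h
    half (even ℕ.zero) (() , _)
    half (even h@(ℕ.suc _)) (_ , resets , least) = h , refl , ℕ.s≤s ℕ.z≤n , Resets-double⇒≡1 h resets , order-least
      where
      order-least : ∀ j → 0 ℕ.< j → b ^ j ≡ 1 [mod m ] → h ℕ.≤ j
      order-least j@(ℕ.suc _) _ b^j≡1 = double-cancel-≤ (least (double j) (ℕ.s≤s ℕ.z≤n) (≡1⇒Resets-double j b^j≡1))
    half (odd h) (_ , resets , _) = ⊥-elim (¬Resets-odd h p-prime p∣m m∣ᶻa² p∤ᶻb resets)

IsOrder-lift : ∀ {d m b h} → d ∣ m → IsOrder d b h → b ^ h ≡ 1 [mod m ] → IsOrder m b h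
IsOrder-lift d∣m (0<h , _ , least) b^h≡1 = 0<h , b^h≡1 , λ j 0<j b^j≡1 → least j 0<j (ℕ∣.∣-trans d∣m b^j≡1)

IsOrder<p : ∀ {p b h} → Prime p → ¬ p ∣ b → IsOrder p b h → h ℕ.< p
IsOrder<p {ℕ.suc (ℕ.suc q)} {b} p-prime p∤b (_ , _ , least) =
  ℕ.s≤s (least (ℕ.suc q) (ℕ.s≤s ℕ.z≤n) (Equivalence.from (^≡1[mod]⇔ b (ℕ.suc q)) (fermat-unit p-prime p∤b)))

p²∣ᶻxy⇒p²∣x : ∀ {p x y} → Prime p → ¬ + p ∣ᶻ y → + (p ^ 2) ∣ᶻ + x * y → p ^ 2 ∣ x
p²∣ᶻxy⇒p²∣x {x = x} {y} p-prime p∤y p²∣xy =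
  p²∣xy⇒p²∣x p-prime (p∤y ∘ ℤ∣.∣ᵤ⇒∣) (subst (_ ∣_) (ℤ.abs-* (+ x) y) (ℤ∣.∣⇒∣ᵤ p²∣xy))

p∣x⇒p²∣x*x : ∀ {p x} → + p ∣ᶻ x → + (p ^ 2) ∣ᶻ x * x
p∣x⇒p²∣x*x {x = x} p∣x = ℤ∣.∣ᵤ⇒∣ (subst (_ ∣_) (sym (ℤ.abs-* x x)) (p∣x⇒p^2∣x*x (ℤ∣.∣⇒∣ᵤ p∣x)))

Resets-double⇒p²∣a : ∀ {p a b h} → Prime p → ¬ p ∣ b → p ∣ a → 0 ℕ.< h → h ℕ.< p →
                     Resets (+ a) (+ b) (p ^ 2) (double h) → p ^ 2 ∣ a
Resets-double⇒p²∣a {p} {a} {b} {h@(ℕ.suc h′)} p-prime p∤b p∣a _ h<p (U₂ₕ≈0 , _) =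
  p²∣ᶻxy⇒p²∣x p-prime
    (∤-* p-prime {+ h} (prime∤0<n<p p-prime (ℕ.s≤s ℕ.z≤n) h<p ∘ ℤ∣.∣⇒∣ᵤ) (∤-^ p-prime {+ b} (p∤b ∘ ℤ∣.∣⇒∣ᵤ) h′))
    (subst (_ ∣ᶻ_) (identity (+ h) (+ a) ((+ b) ^ᶻ h′))
      (≈0⇒∣ (≈-trans (≈-sym (Uᶻ-even (+ a) (+ b) (p∣x⇒p²∣x*x {x = + a} (ℤ∣.∣ᵤ⇒∣ p∣a)) h′)) U₂ₕ≈0)))
  where
  identity : ∀ h a B → h * a * B ≡ a * (h * B)
  identity = solve-∀

SamePeriod-p∣a⇔ : ∀ {p a b} → Prime p → ¬ p ∣ b → p ∣ a →
  SamePeriod (+ a) (+ b) p (p ^ 2) ⇔ ((∃ λ k → IsOrder (p ^ 2) b k × IsOrder p b k) × p ^ 2 ∣ a)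
SamePeriod-p∣a⇔ {p} {a} {b} p-prime p∤b p∣a = mk⇔ forward backward
  where
  forward : SamePeriod (+ a) (+ b) p (p ^ 2) → (∃ λ k → IsOrder (p ^ 2) b k × IsOrder p b k) × p ^ 2 ∣ a
  forward (k , πₚ , πₚ²) with IsPeriodᶻ⇒IsOrder-half p-prime ℕ∣.∣-refl p∣a p∤b πₚ
  ... | h , refl , ord-p@(0<h , _) =
    (h , IsOrder-lift (p∣p^2 p) ord-p b^h≡1 , ord-p) ,
    Resets-double⇒p²∣a p-prime p∤b p∣a 0<h (IsOrder<p p-prime p∤b ord-p) resets
    where
    resets = proj₁ (proj₂ πₚ²)
    b^h≡1 : b ^ h ≡ 1 [mod p ^ 2 ]
    b^h≡1 = Equivalence.from (^≡1[mod]⇔ b h)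
      (Resets-double⇒^≈1 h (p∣x⇒p²∣x*x {x = + a} (ℤ∣.∣ᵤ⇒∣ p∣a)) resets)
  backward : (∃ λ k → IsOrder (p ^ 2) b k × IsOrder p b k) × p ^ 2 ∣ a → SamePeriod (+ a) (+ b) p (p ^ 2)
  backward ((k , ord-p² , ord-p) , p²∣a) =
    double k , IsOrder⇒IsPeriodᶻ-double p-prime ℕ∣.∣-refl p∣a p∤b ord-p ,
               IsOrder⇒IsPeriodᶻ-double p-prime (p∣p^2 p) p²∣a p∤b ord-p²

module _ (a b : ℤ) where

  Δ : ℤ
  Δ = a * a + + 4 * b

  private
    scaled : ℕ → ℤ
    scaled n = + 6 * (a * a * a) * (+ 2) ^ᶻ n * Uᶻ a b n

    E : ℤ → ℤ → ℤ
    E N P = N * (+ 12 * (a * a) * P + + 2 * (N - 1ℤ) * (N - + 2) * P * Δ)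

  -- From 2ⁿ⁻¹Uₙ = Σᵢ C(n,2i+1) aⁿ⁻²ⁱ⁻¹ Δⁱ only i = 0, 1 survive modulo Δ²;
  -- the factor 12a³ clears the denominator of C(n,3) and the negative powers of a.
  Uᶻ-mod-Δ² : ∀ {m} → + m ∣ᶻ Δ * Δ → ∀ n →
    + 6 * (a * a * a) * (+ 2) ^ᶻ n * Uᶻ a b n ≈
    + n * (+ 12 * (a * a) * a ^ᶻ n + + 2 * (+ n - 1ℤ) * (+ n - + 2) * a ^ᶻ n * Δ) [mod m ]
  Uᶻ-mod-Δ² {m} m∣Δ² n = proj₁ (pair n)
    where
    pair : ∀ n → scaled n ≈ E (+ n) (a ^ᶻ n) [mod m ] × scaled (ℕ.suc n) ≈ E (+ ℕ.suc n) (a ^ᶻ ℕ.suc n) [mod m ]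
    pair ℕ.zero = ≈-reflexive (identity₀ a b) , ≈-reflexive (identity₁ a b)
      where
      identity₀ : ∀ a b → + 6 * (a * a * a) * 1ℤ * 0ℤ ≡
                  0ℤ * (+ 12 * (a * a) * 1ℤ + + 2 * (0ℤ - 1ℤ) * (0ℤ - + 2) * 1ℤ * (a * a + + 4 * b))
      identity₀ = solve-∀
      identity₁ : ∀ a b → + 6 * (a * a * a) * (+ 2 * 1ℤ) * 1ℤ ≡
                  1ℤ * (+ 12 * (a * a) * (a * 1ℤ) + + 2 * (1ℤ - 1ℤ) * (1ℤ - + 2) * (a * 1ℤ) * (a * a + + 4 * b))
      identity₁ = solve-∀
    pair (ℕ.suc n) = proj₂ (pair n) , (begin
      scaled (ℕ.suc (ℕ.suc n))
        ≡⟨ recurrence a b ((+ 2) ^ᶻ n) (Uᶻ a b n) (Uᶻ a b (ℕ.suc n)) ⟩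
      (+ 2 * a) * scaled (ℕ.suc n) + (Δ - a * a) * scaled n
        ≈⟨ +-cong (*-congˡ {c = + 2 * a} (proj₂ (pair n))) (*-congˡ {c = Δ - a * a} (proj₁ (pair n))) ⟩
      (+ 2 * a) * E (+ ℕ.suc n) (a * P) + (Δ - a * a) * E N P
        ≡⟨ cong (λ N′ → (+ 2 * a) * E N′ (a * P) + (Δ - a * a) * E N P) (ℤ.pos-+ 1 n) ⟩
      (+ 2 * a) * E (1ℤ + N) (a * P) + (Δ - a * a) * E N P
        ≡⟨ expansion a b N P ⟩
      E (+ 2 + N) (a * (a * P)) + (Δ * Δ) * (+ 2 * N * (N - 1ℤ) * (N - + 2) * P)
        ≈⟨ x+z≈x (ℤ∣.∣m⇒∣m*n (+ 2 * N * (N - 1ℤ) * (N - + 2) * P) m∣Δ²) ⟩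
      E (+ 2 + N) (a * (a * P))
        ≡⟨ cong (λ N′ → E N′ (a * (a * P))) (ℤ.pos-+ 2 n) ⟨
      E (+ ℕ.suc (ℕ.suc n)) (a ^ᶻ ℕ.suc (ℕ.suc n)) ∎)
      where
      open ≈-Reasoning m
      N = + n
      P = a ^ᶻ n
      recurrence : ∀ a b T U₀ U₁ →
        + 6 * (a * a * a) * (+ 2 * (+ 2 * T)) * (a * U₁ + b * U₀) ≡
        (+ 2 * a) * (+ 6 * (a * a * a) * (+ 2 * T) * U₁) + ((a * a + + 4 * b) - a * a) * (+ 6 * (a * a * a) * T * U₀)
      recurrence = solve-∀
      expansion : ∀ a b N P → let Δ = a * a + + 4 * b in
        (+ 2 * a) * ((1ℤ + N) * (+ 12 * (a * a) * (a * P) + + 2 * ((1ℤ + N) - 1ℤ) * ((1ℤ + N) - + 2) * (a * P) * Δ))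
          + (Δ - a * a) * (N * (+ 12 * (a * a) * P + + 2 * (N - 1ℤ) * (N - + 2) * P * Δ)) ≡
        (+ 2 + N) * (+ 12 * (a * a) * (a * (a * P)) + + 2 * ((+ 2 + N) - 1ℤ) * ((+ 2 + N) - + 2) * (a * (a * P)) * Δ)
          + (Δ * Δ) * (+ 2 * N * (N - 1ℤ) * (N - + 2) * P)
      expansion = solve-∀

module _ {p a b} (p-prime : Prime p) (5≤p : 5 ℕ.≤ p) (p∤a : ¬ p ∣ a) (p∣Δ : + p ∣ᶻ Δ (+ a) (+ b)) where

  private
    A = + a
    B = + b

    p∤2 : ¬ + p ∣ᶻ + 2
    p∤2 = prime∤0<n<p p-prime (ℕ.s≤s ℕ.z≤n) (ℕ.<-≤-trans (ℕ.s≤s (ℕ.s≤s (ℕ.s≤s ℕ.z≤n))) 5≤p) ∘ ℤ∣.∣⇒∣ᵤ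

    p∤3 : ¬ + p ∣ᶻ + 3
    p∤3 = prime∤0<n<p p-prime (ℕ.s≤s ℕ.z≤n) (ℕ.<-≤-trans (ℕ.s≤s (ℕ.s≤s (ℕ.s≤s (ℕ.s≤s ℕ.z≤n)))) 5≤p) ∘ ℤ∣.∣⇒∣ᵤ

    p∤A : ¬ + p ∣ᶻ A
    p∤A = p∤a ∘ ℤ∣.∣⇒∣ᵤ

    p∤6 : ¬ + p ∣ᶻ + 6
    p∤6 = ∤-* p-prime {+ 2} {+ 3} p∤2 p∤3

    p∤12A²Aⁿ : ∀ n → ¬ + p ∣ᶻ + 12 * (A * A) * A ^ᶻ n
    p∤12A²Aⁿ n = ∤-* p-prime (∤-* p-prime (∤-* p-prime {+ 2} {+ 6} p∤2 p∤6) (∤-* p-prime p∤A p∤A)) (∤-^ p-prime p∤A n)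

    p∤6A³2ⁿ : ∀ n → ¬ + p ∣ᶻ + 6 * (A * A * A) * (+ 2) ^ᶻ n
    p∤6A³2ⁿ n = ∤-* p-prime (∤-* p-prime p∤6 (∤-* p-prime (∤-* p-prime p∤A p∤A) p∤A)) (∤-^ p-prime p∤2 n)

    Uᶻ-mod-p : ∀ n → + 6 * (A * A * A) * (+ 2) ^ᶻ n * Uᶻ A B n ≈ + n * (+ 12 * (A * A) * A ^ᶻ n) [mod p ]
    Uᶻ-mod-p n = ≈-trans (Uᶻ-mod-Δ² A B (ℤ∣.∣m⇒∣m*n (Δ A B) p∣Δ) n)
      (*-congˡ {c = + n} (x+z≈x (ℤ∣.∣n⇒∣m*n (+ 2 * (+ n - 1ℤ) * (+ n - + 2) * A ^ᶻ n) p∣Δ)))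

  Uᶻ≈0-mod-p²⇒p²∣n : ∀ n → Uᶻ A B n ≈ 0ℤ [mod p ^ 2 ] → p ^ 2 ∣ n
  Uᶻ≈0-mod-p²⇒p²∣n n Uₙ≈0 = p²∣ᶻxy⇒p²∣x p-prime p∤Z (≈0⇒∣ (begin
    + n * Z                                             ≈⟨ Uᶻ-mod-Δ² A B (p∣x⇒p²∣x*x p∣Δ) n ⟨
    + 6 * (A * A * A) * (+ 2) ^ᶻ n * Uᶻ A B n           ≈⟨ *-congˡ {c = + 6 * (A * A * A) * (+ 2) ^ᶻ n} Uₙ≈0 ⟩
    + 6 * (A * A * A) * (+ 2) ^ᶻ n * 0ℤ                ≡⟨ ℤ.*-zeroʳ (+ 6 * (A * A * A) * (+ 2) ^ᶻ n) ⟩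
    0ℤ                                                  ∎))
    where
    open ≈-Reasoning (p ^ 2)
    W = + 2 * (+ n - 1ℤ) * (+ n - + 2) * A ^ᶻ n
    Z = + 12 * (A * A) * A ^ᶻ n + W * Δ A B
    p∤Z : ¬ + p ∣ᶻ Z
    p∤Z p∣Z = p∤12A²Aⁿ n (ℤ∣.∣m+n∣n⇒∣m p∣Z (ℤ∣.∣n⇒∣m*n W p∣Δ))

  -- For j = (p-1)p the factor j vanishes modulo p, and 2ʲ ≡ aʲ ≡ 1 by Fermat.
  Resets-[p-1]p : Resets A B p ((p ℕ.∸ 1) ℕ.* p)
  Resets-[p-1]p = *-cancelˡ-≈ p-prime (p∤6A³2ⁿ j) Uⱼ≈0 , *-cancelˡ-≈ p-prime p∤12A³ Uⱼ₊₁≈1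
    where
    open ≈-Reasoning p
    j = (p ℕ.∸ 1) ℕ.* p
    p∣j : + p ∣ᶻ + j
    p∣j = ℤ∣.∣ᵤ⇒∣ (ℕ∣.n∣m*n (p ℕ.∸ 1))
    Uⱼ≈0 : + 6 * (A * A * A) * (+ 2) ^ᶻ j * Uᶻ A B j ≈ + 6 * (A * A * A) * (+ 2) ^ᶻ j * 0ℤ [mod p ]
    Uⱼ≈0 = begin
      + 6 * (A * A * A) * (+ 2) ^ᶻ j * Uᶻ A B j  ≈⟨ Uᶻ-mod-p j ⟩
      + j * (+ 12 * (A * A) * A ^ᶻ j)            ≈⟨ ∣⇒≈0 (ℤ∣.∣m⇒∣m*n (+ 12 * (A * A) * A ^ᶻ j) p∣j) ⟩
      0ℤ                                         ≡⟨ ℤ.*-zeroʳ (+ 6 * (A * A * A) * (+ 2) ^ᶻ j) ⟨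
      + 6 * (A * A * A) * (+ 2) ^ᶻ j * 0ℤ        ∎
    p∤12A³ : ¬ + p ∣ᶻ + 12 * (A * A * A)
    p∤12A³ p∣12A³ = p∤12A²Aⁿ 1 (subst (+ p ∣ᶻ_) (identity A) p∣12A³)
      where
      identity : ∀ A → + 12 * (A * A * A) ≡ + 12 * (A * A) * (A * 1ℤ)
      identity = solve-∀
    Uⱼ₊₁≈1 : + 12 * (A * A * A) * Uᶻ A B (ℕ.suc j) ≈ + 12 * (A * A * A) * 1ℤ [mod p ]
    Uⱼ₊₁≈1 = begin
      + 12 * (A * A * A) * Uᶻ A B (ℕ.suc j)                  ≡⟨ identity₁ A (Uᶻ A B (ℕ.suc j)) ⟩
      + 6 * (A * A * A) * (+ 2 * 1ℤ) * Uᶻ A B (ℕ.suc j)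
        ≈⟨ *-cong (*-congˡ {c = + 6 * (A * A * A)} (*-congˡ {c = + 2} (^[p-1]p≈1 p-prime p∤2ℕ))) ≈-refl ⟨
      + 6 * (A * A * A) * (+ 2) ^ᶻ ℕ.suc j * Uᶻ A B (ℕ.suc j) ≈⟨ Uᶻ-mod-p (ℕ.suc j) ⟩
      + ℕ.suc j * (+ 12 * (A * A) * (A * A ^ᶻ j))
        ≡⟨ cong (λ J → J * (+ 12 * (A * A) * (A * A ^ᶻ j))) (ℤ.pos-+ 1 j) ⟩
      (1ℤ + + j) * (+ 12 * (A * A) * (A * A ^ᶻ j))
        ≈⟨ *-cong (+-cong (≈-refl {x = 1ℤ}) (∣⇒≈0 p∣j))
                  (*-congˡ {c = + 12 * (A * A)} (*-congˡ {c = A} (^[p-1]p≈1 p-prime p∤a))) ⟩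
      (1ℤ + 0ℤ) * (+ 12 * (A * A) * (A * 1ℤ))                ≡⟨ identity₂ A ⟩
      + 12 * (A * A * A) * 1ℤ                                ∎
      where
      p∤2ℕ : ¬ p ∣ 2
      p∤2ℕ = p∤2 ∘ ℤ∣.∣ᵤ⇒∣
      identity₁ : ∀ A U → + 12 * (A * A * A) * U ≡ + 6 * (A * A * A) * (+ 2 * 1ℤ) * U
      identity₁ = solve-∀
      identity₂ : ∀ A → (1ℤ + 0ℤ) * (+ 12 * (A * A) * (A * 1ℤ)) ≡ + 12 * (A * A * A) * 1ℤ
      identity₂ = solve-∀

¬SamePeriod-p∣Δ : ∀ {p a b} → Prime p → 5 ℕ.≤ p → ¬ p ∣ b → p ∣ a ℕ.* a ℕ.+ 4 ℕ.* b →
                  ¬ SamePeriod (+ a) (+ b) p (p ^ 2)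
¬SamePeriod-p∣Δ {p@(ℕ.suc q@(ℕ.suc _))} {a} {b} p-prime 5≤p p∤b p∣Δ
                (k , (_ , _ , leastₚ) , (0<k , (Uₖ≈0 , _) , _)) =
  ℕ.<⇒≱ (ℕ.≤-<-trans k≤q*p q*p<p²) (ℕ∣.∣⇒≤ {{ℕ.>-nonZero 0<k}} p²∣k)
  where
  p∤a : ¬ p ∣ a
  p∤a p∣a with euclidsLemma 4 b p-prime (ℕ∣.∣m+n∣m⇒∣n p∣Δ (ℕ∣.∣m⇒∣m*n a p∣a))
  ... | inj₁ p∣4 = ℕ.<⇒≱ 5≤p (ℕ∣.∣⇒≤ p∣4)
  ... | inj₂ p∣b = p∤b p∣b
  p∣ᶻΔ : + p ∣ᶻ Δ (+ a) (+ b)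
  p∣ᶻΔ = subst (_ ∣ᶻ_) (trans (ℤ.pos-+ (a ℕ.* a) (4 ℕ.* b)) (cong₂ _+_ (ℤ.pos-* a a) (ℤ.pos-* 4 b))) (ℤ∣.∣ᵤ⇒∣ p∣Δ)
  p²∣k : p ^ 2 ∣ k
  p²∣k = Uᶻ≈0-mod-p²⇒p²∣n p-prime 5≤p p∤a p∣ᶻΔ k Uₖ≈0
  k≤q*p : k ℕ.≤ q ℕ.* p
  k≤q*p = leastₚ (q ℕ.* p) (ℕ.s≤s ℕ.z≤n) (Resets-[p-1]p p-prime 5≤p p∤a p∣ᶻΔ)
  q*p<p² : q ℕ.* p ℕ.< p ^ 2
  q*p<p² = subst (q ℕ.* p ℕ.<_) (sym (p^2≡p*p p)) (ℕ.*-monoˡ-< p (ℕ.n<1+n q))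

lemma3p3 : (a b p : ℕ) → a ≥ 1 → b ≥ 1 → ¬ (4 ∣ a) → SquareFree b → SquareFree (𝒟 a b) →
    Prime p → ¬ (p ∣ b) →
    ((p ≡ 2 → (WallSunSun a b p ⇔ ((a % 4 ≡ 3) × (b % 4 ≡ 3)))) ×
    (p ≥ 3 → p ∣ a →
    (WallSunSun a b p ⇔ ((∃ λ k → IsOrder (p ^ 2) b k × IsOrder p b k) × (p ^ 2 ∣ a)))) ×
    (p ≥ 5 → p ∣ 𝒟 a b → ¬ WallSunSun a b p))
lemma3p3 a b p _ _ 4∤a _ _ p-prime p∤b =
    (λ { refl → SamePeriod-mod-2-4⇔ 4∤a p∤b ⇔-∘ WallSunSun⇔SamePeriod p-prime p∤b })
  , (λ _ p∣a → SamePeriod-p∣a⇔ p-prime p∤b p∣a ⇔-∘ WallSunSun⇔SamePeriod p-prime p∤b)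
  , (λ 5≤p p∣𝒟 → ¬SamePeriod-p∣Δ p-prime 5≤p p∤b (ℕ∣.∣-trans p∣𝒟 (𝒟∣a²+4b a b))
                 ∘ Equivalence.to (WallSunSun⇔SamePeriod p-prime p∤b))
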